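{- For every set of formulas $\Gamma\cup\{\psi\}$ (finite or infinite): $\Gamma\models_{\sf LFI1}\psi$ if and only if $\Gamma,\ (\mathrm{var}(\Gamma))^{\text{☆}},\ (\mathrm{var}(\psi))^{\text{☆}}\models_{\sf BD2}\psi$, where $(\mathrm{var}(\Gamma))^{\text{☆}}=\{\text{☆}p : p \text{ a propositional variable occurring in }\Gamma\}$, $(\mathrm{var}(\psi))^{\text{☆}}=\{\text{☆}p : p \text{ occurring in }\psi\}$, and $\text{☆}\alpha:=\copyright\copyright\alpha$.
   Context: Let $\mathbf 4=\{1,\mathbf b,\mathbf n,0\}$ be the lattice with $0<\mathbf b<1$, $0<\mathbf n<1$, $\mathbf b,\mathbf n$ incomparable; $\wedge,\vee$ meet and join. The algebra ${\bf A}_{\sf BD2}$ on $\mathbf 4$ over $\{\wedge,\vee,\to,\neg,\copyright\}$ has: $\neg 1=0$, $\neg\mathbf b=\mathbf b$, $\neg\mathbf n=\mathbf n$, $\neg 0=1$; $\copyright 1=1$, $\copyright\mathbf b=0$, $\copyright\mathbf n=\mathbf b$, $\copyright 0=1$; $x\to y=y$ if $x\in\{1,\mathbf b\}$; $0\to y=1$; $\mathbf n\to 1=\mathbf n\to\mathbf n=1$, $\mathbf n\to\mathbf b=\mathbf n\to 0=\mathbf b$. ${\sf BD2}$ is the logic of the matrix $\langle{\bf A}_{\sf BD2},\{1,\mathbf b\}\rangle$ ($\Gamma\models\psi$ iff every valuation designating all of $\Gamma$ designates $\psi$). ${\sf LFI1}$ is the logic of the submatrix with domain $\{1,\mathbf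 b,0\}$ and designated set $\{1,\mathbf b\}$. -}

module Defs where

open import Data.Nat using (ℕ)
open import Data.Product using (Σ; _×_; ∃)
open import Data.Sum using (_⊎_)
open import Relation.Binary.PropositionalEquality using (_≡_; _≢_)

data V4 : Set where
  one b n zer : V4

_∧₄_ : V4 → V4 → V4
one ∧₄ y = y
zer ∧₄ y = zer
b ∧₄ one = b
b ∧₄ b = b
b ∧₄ n = zer
b ∧₄ zer = zer
n ∧₄ one = n
n ∧₄ b = zer
n ∧₄ n = n
n ∧₄ zer = zer

_∨₄_ : V4 → V4 → V4
one ∨₄ y = one
zer ∨₄ y = y
b ∨₄ one = one
b ∨₄ b = b
b ∨₄ n = one
b ∨₄ zer = b
n ∨₄ one = one
n ∨₄ b = one
n ∨₄ n = n
n ∨₄ zer = n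

¬₄ : V4 → V4
¬₄ one = zer
¬₄ b = b
¬₄ n = n
¬₄ zer = one

©₄ : V4 → V4
©₄ one = one
©₄ b = zer
©₄ n = b
©₄ zer = one

_⇒₄_ : V4 → V4 → V4
one ⇒₄ y = y
b ⇒₄ y = y
zer ⇒₄ y = one
n ⇒₄ one = one
n ⇒₄ n = one
n ⇒₄ b = b
n ⇒₄ zer = b

Designated : V4 → Set
Designated x = (x ≡ one) ⊎ (x ≡ b)

data Formula : Set where
  var  : ℕ → Formula
  _∧'_ : Formula → Formula → Formula
  _∨'_ : Formula → Formula → Formula
  _⇒'_ : Formula → Formula → Formula
  ¬'   : Formula → Formula
  ©'   : Formula → Formula

☆ : Formula → Formula
☆ α = ©' (©' α)

data Occurs (p : ℕ) : Formula → Set where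
  occ-var : Occurs p (var p)
  occ-∧l : ∀ {φ ψ} → Occurs p φ → Occurs p (φ ∧' ψ)
  occ-∧r : ∀ {φ ψ} → Occurs p ψ → Occurs p (φ ∧' ψ)
  occ-∨l : ∀ {φ ψ} → Occurs p φ → Occurs p (φ ∨' ψ)
  occ-∨r : ∀ {φ ψ} → Occurs p ψ → Occurs p (φ ∨' ψ)
  occ-⇒l : ∀ {φ ψ} → Occurs p φ → Occurs p (φ ⇒' ψ)
  occ-⇒r : ∀ {φ ψ} → Occurs p ψ → Occurs p (φ ⇒' ψ)
  occ-¬  : ∀ {φ} → Occurs p φ → Occurs p (¬' φ)
  occ-©  : ∀ {φ} → Occurs p φ → Occurs p (©' φ)

Assignment : Set
Assignment = ℕ → V4

eval : Assignment → Formula → V4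
eval v (var p) = v p
eval v (φ ∧' ψ) = eval v φ ∧₄ eval v ψ
eval v (φ ∨' ψ) = eval v φ ∨₄ eval v ψ
eval v (φ ⇒' ψ) = eval v φ ⇒₄ eval v ψ
eval v (¬' φ) = ¬₄ (eval v φ)
eval v (©' φ) = ©₄ (eval v φ)

FSet : Set₁
FSet = Formula → Set

_⊨BD2_ : FSet → Formula → Set
Γ ⊨BD2 ψ = ∀ (v : Assignment) → (∀ γ → Γ γ → Designated (eval v γ)) → Designated (eval v ψ)

-- Consequence in LFI1: the submatrix on {1, b, 0}; its valuations are exactly
-- the valuations into A_BD2 whose variable assignment avoids n
-- ({1,b,0} is closed under all operations).
_⊨LFI1_ : FSet → Formula → Set
Γ ⊨LFI1 ψ = ∀ (v : Assignment) → (∀ p → v p ≢ n) →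
  (∀ γ → Γ γ → Designated (eval v γ)) → Designated (eval v ψ)

StarExt : FSet → Formula → FSet
StarExt Γ ψ φ =
  Γ φ
  ⊎ Σ ℕ (λ p → (φ ≡ ☆ (var p)) × ∃ (λ γ → Γ γ × Occurs p γ))
  ⊎ Σ ℕ (λ p → (φ ≡ ☆ (var p)) × Occurs p ψ)

module Submission where

open import Data.Empty using (⊥-elim)
open import Data.Product using (_,_)
open import Data.Sum using (inj₁; inj₂)
open import Function.Base using (_∘_)
open import Function.Bundles using (_⇔_; mk⇔)
open import Relation.Binary.PropositionalEquality using (_≡_; _≢_; refl; sym; cong; cong₂; subst)

open import Defs

-- ☆x is designated exactly when x ≠ n. So an LFI1 valuation designates every ☆p, and a
-- BD2 valuation designating ☆p for all variables of Γ and ψ takes no value n there; it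
-- then agrees on Γ and ψ with the LFI1 valuation obtained by sending n to 0.

☆₄-designated : ∀ x → x ≢ n → Designated (©₄ (©₄ x))
☆₄-designated one _ = inj₁ refl
☆₄-designated b   _ = inj₁ refl
☆₄-designated n   x≢n = ⊥-elim (x≢n refl)
☆₄-designated zer _ = inj₁ refl

☆₄-designated⇒≢n : ∀ x → Designated (©₄ (©₄ x)) → x ≢ n
☆₄-designated⇒≢n n (inj₁ ()) refl
☆₄-designated⇒≢n n (inj₂ ()) refl

n↦zer : V4 → V4
n↦zer n = zer
n↦zer x = x

n↦zer-≢n : ∀ x → n↦zer x ≢ n
n↦zer-≢n one ()
n↦zer-≢n b   ()
n↦zer-≢n n   ()
n↦zer-≢n zer ()

n↦zer-id : ∀ x → x ≢ n → n↦zer x ≡ x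
n↦zer-id one _ = refl
n↦zer-id b   _ = refl
n↦zer-id n   x≢n = ⊥-elim (x≢n refl)
n↦zer-id zer _ = refl

eval-cong-occurs : ∀ (v w : Assignment) φ → (∀ p → Occurs p φ → v p ≡ w p) → eval v φ ≡ eval w φ
eval-cong-occurs v w (var p)  v≡w = v≡w p occ-var
eval-cong-occurs v w (φ ∧' ψ) v≡w =
  cong₂ _∧₄_ (eval-cong-occurs v w φ (λ p → v≡w p ∘ occ-∧l)) (eval-cong-occurs v w ψ (λ p → v≡w p ∘ occ-∧r))
eval-cong-occurs v w (φ ∨' ψ) v≡w =
  cong₂ _∨₄_ (eval-cong-occurs v w φ (λ p → v≡w p ∘ occ-∨l)) (eval-cong-occurs v w ψ (λ p → v≡w p ∘ occ-∨r))
eval-cong-occurs v w (φ ⇒' ψ) v≡w =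
  cong₂ _⇒₄_ (eval-cong-occurs v w φ (λ p → v≡w p ∘ occ-⇒l)) (eval-cong-occurs v w ψ (λ p → v≡w p ∘ occ-⇒r))
eval-cong-occurs v w (¬' φ)   v≡w = cong ¬₄ (eval-cong-occurs v w φ (λ p → v≡w p ∘ occ-¬))
eval-cong-occurs v w (©' φ)   v≡w = cong ©₄ (eval-cong-occurs v w φ (λ p → v≡w p ∘ occ-©))

eval-n↦zer : ∀ (v : Assignment) φ → (∀ p → Occurs p φ → Designated (eval v (☆ (var p)))) →
             eval (n↦zer ∘ v) φ ≡ eval v φ
eval-n↦zer v φ ☆-des = eval-cong-occurs (n↦zer ∘ v) v φ
  (λ p occ → n↦zer-id (v p) (☆₄-designated⇒≢n (v p) (☆-des p occ)))

mainTheorem6 : (Γ : FSet) (ψ : Formula) → (Γ ⊨LFI1 ψ) ⇔ (StarExt Γ ψ ⊨BD2 ψ)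
mainTheorem6 Γ ψ = mk⇔ to from
  where
  to : Γ ⊨LFI1 ψ → StarExt Γ ψ ⊨BD2 ψ
  to Γ⊨ψ v v⊨Γ☆ = subst Designated (eval-n↦zer v ψ ☆ψ)
    (Γ⊨ψ (n↦zer ∘ v) (n↦zer-≢n ∘ v)
      (λ γ γ∈Γ → subst Designated (sym (eval-n↦zer v γ (☆Γ γ∈Γ))) (v⊨Γ☆ γ (inj₁ γ∈Γ))))
    where
    ☆Γ : ∀ {γ} → Γ γ → ∀ p → Occurs p γ → Designated (eval v (☆ (var p)))
    ☆Γ γ∈Γ p occ = v⊨Γ☆ _ (inj₂ (inj₁ (p , refl , _ , γ∈Γ , occ)))
    ☆ψ : ∀ p → Occurs p ψ → Designated (eval v (☆ (var p)))
    ☆ψ p occ = v⊨Γ☆ _ (inj₂ (inj₂ (p , refl , occ)))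

  from : StarExt Γ ψ ⊨BD2 ψ → Γ ⊨LFI1 ψ
  from Γ☆⊨ψ v v≢n v⊨Γ = Γ☆⊨ψ v v⊨Γ☆
    where
    v⊨Γ☆ : ∀ φ → StarExt Γ ψ φ → Designated (eval v φ)
    v⊨Γ☆ φ (inj₁ φ∈Γ) = v⊨Γ φ φ∈Γ
    v⊨Γ☆ _ (inj₂ (inj₁ (p , refl , _))) = ☆₄-designated (v p) (v≢n p)
    v⊨Γ☆ _ (inj₂ (inj₂ (p , refl , _))) = ☆₄-designated (v p) (v≢n p)
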